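{- $FV(s\circ\lambda a.M)=FV(\lambda a.\Uparrow_a\!(s)\circ M)$, i.e. $FV(s\circ\lambda a.M)=FV(\lambda a.\langle\pi_a\circ s\,,\,a\backslash a\rangle\circ M)$.
   Context: $\lambda\pi$ terms $M::= a\mid MN\mid\lambda a.M\mid s\circ M$, substitutions $s::= id\mid\pi_a\mid\langle s\,,\,N\backslash a\rangle\mid s\circ q$. $FV(M)=\langle FV_1(M),FV_2(M),\ldots\rangle$ (sequence of sets, level-indexed free variables): $FV(a)=\langle\{a\},\emptyset,\ldots\rangle$, $FV(MN)=FV(M)\cup FV(N)$ (componentwise), $FV(\lambda a.M)=O_{\lambda a}(FV(M))$, $FV(s\circ M)=O_s(FV(M))$, where $O_{\lambda a}(\mathcal A)=\langle(\mathcal A_1\setminus\{a\})\cup\mathcal A_2,\mathcal A_3,\ldots\rangle$, $O_{id}(\mathcal A)=\mathcal A$, $O_{\pi_a}(\mathcal A)=\langle\emptyset,\mathcal A_1,\mathcal A_2,\ldots\rangle$, $O_{s\circ q}(\mathcal A)=O_s(O_q(\mathcal A))$, $O_{\langle s,N\backslash a\rangle}(\mathcal A)=O_s(O_{\lambda a}(\mathcal A))\cup FV(N)$. $\Uparrow_a(s)\equiv\langle\pi_a\circ s\,,\,a\backslash a\rangle$. -}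

module Defs where

open import Data.Nat using (ℕ; zero; suc)
open import Data.Empty using (⊥)
open import Data.Sum using (_⊎_)
open import Data.Product using (_×_)
open import Relation.Binary.PropositionalEquality using (_≡_)
open import Relation.Nullary using (¬_)
open import Function.Bundles using (_⇔_)

-- Variables (names): natural numbers, an infinite set with decidable equality.
Var : Set
Var = ℕ

data Term : Set
data Subst : Set

data Term where
  var  : Var → Term
  app  : Term → Term → Term
  lam  : Var → Term → Term
  sub  : Subst → Term → Term        -- s ∘ M

data Subst where
  idˢ  : Subst
  π    : Var → Subst
  ext  : Subst → Term → Var → Subst -- ⟨ s , N \ a ⟩
  comp : Subst → Subst → Subst

-- A set of variables is a predicate on Var; a level-indexed sequence
-- ⟨A₁, A₂, …⟩ is a function ℕ → Set-of-vars, where index 0 is level 1.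
VarSet : Set₁
VarSet = Var → Set

Seq : Set₁
Seq = ℕ → VarSet

∅ : VarSet
∅ _ = ⊥

_∪_ : Seq → Seq → Seq
(A ∪ B) i x = A i x ⊎ B i x

Oλ : Var → Seq → Seq
Oλ a A zero    x = (A 0 x × ¬ (x ≡ a)) ⊎ A 1 x
Oλ a A (suc i) x = A (suc (suc i)) x

Oπ : Seq → Seq
Oπ A zero    = ∅
Oπ A (suc i) = A i

FV : Term → Seq
O  : Subst → Seq → Seq

FV (var a) zero    x = x ≡ a
FV (var a) (suc i) x = ⊥
FV (app M N)       = FV M ∪ FV N
FV (lam a M)       = Oλ a (FV M)
FV (sub s M)       = O s (FV M)

O idˢ        A = A
O (π a)      A = Oπ A
O (comp s q) A = O s (O q A)
O (ext s N a) A = O s (Oλ a A) ∪ FV N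

⇑ : Var → Subst → Subst
⇑ a s = ext (comp (π a) s) (var a) a

_≋_ : Seq → Seq → Set
A ≋ B = ∀ (i : ℕ) (x : Var) → A i x ⇔ B i x

module Submission where

-- Writing A = FV(M)
-- and B = O_s(O_{λa}(A)), the left side is B itself, while by definition of
-- ⇑_a(s) = ⟨π_a ∘ s , a\a⟩ the right side unfolds to
--   O_{λa}(O_{π_a}(B) ∪ FV(a)).
-- So the theorem is an instance of a fact about arbitrary level-indexed
-- sequences B: binding a with λ cancels shifting B up one level with π_a
-- and putting a alone at level 1.  At level 1 the a contributed by FV(a) is
-- removed again by λa and the shifted level 2 of B returns to level 1; at
-- higher levels λa and π_a merely shift in opposite directions.

open import Defs
open import Data.Nat using (zero; suc)
open import Data.Sum using (inj₁; inj₂)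
open import Data.Product using (_,_)
open import Data.Empty using (⊥-elim)
open import Function.Bundles using (mk⇔)
import Function.Properties.Equivalence as ⇔

≋-sym : ∀ {A B : Seq} → A ≋ B → B ≋ A
≋-sym A≋B i x = ⇔.sym (A≋B i x)

λ-cancels-lift : ∀ (a : Var) (B : Seq) → Oλ a (Oπ B ∪ FV (var a)) ≋ B
λ-cancels-lift a B zero x = mk⇔ level₁ (λ b → inj₂ (inj₁ b))
  where
  -- At level 1 the only new element is a itself, which λa excludes.
  level₁ : Oλ a (Oπ B ∪ FV (var a)) zero x → B zero x
  level₁ (inj₁ (inj₁ () , _))
  level₁ (inj₁ (inj₂ x≡a , x≢a)) = ⊥-elim (x≢a x≡a)
  level₁ (inj₂ (inj₁ b))         = b
  level₁ (inj₂ (inj₂ ()))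
λ-cancels-lift a B (suc i) x = mk⇔ level₊ inj₁
  where
  -- Above level 1, FV(a) is empty and the two shifts cancel.
  level₊ : Oλ a (Oπ B ∪ FV (var a)) (suc i) x → B (suc i) x
  level₊ (inj₁ b)  = b
  level₊ (inj₂ ())

mainTheorem14 : ∀ (s : Subst) (a : Var) (M : Term) →
    FV (sub s (lam a M)) ≋ FV (lam a (sub (⇑ a s) M))
mainTheorem14 s a M = ≋-sym (λ-cancels-lift a (O s (Oλ a (FV M))))
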